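{- Let $b \geq 2$ and $n \geq 2$ be integers, and define \[ m_{b,n} = b^n - b^2 + 3b - 3, \qquad M_{b,n} = b^{n+1} - b^2 - (n-1)(b-1)^2 + (b - \lfloor b/2\rfloor)\lfloor b/2 \rfloor. \] For an integer $c \ge 0$ let $S_{[c,b]}:\mathbb{Z}^+\to\mathbb{Z}^+$ be defined by $S_{[c,b]}\left(\sum_{i=0}^k a_i b^i\right) = c + \sum_{i=0}^k a_i^2$ (base $b$ expansion, $0\le a_i\le b-1$, $a_k\ne0$). If $S_{[c,b]}$ has a fixed point with exactly $n+1$ digits in base $b$, then $m_{b,n} \leq c \leq M_{b,n}$. Further, these bounds are sharp, i.e., both $S_{[m_{b,n},b]}$ and $S_{[M_{b,n},b]}$ have a fixed point with exactly $n+1$ base-$b$ digits.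
   Context: A fixed point of $S_{[c,b]}$ is a positive integer $a$ with $S_{[c,b]}(a)=a$. -}

module Defs where

open import Data.Nat using (ℕ; zero; suc; _+_; _*_; _∸_; _^_; _<_; NonZero)
open import Data.Nat.ListAction using (sum)
open import Data.Nat.DivMod using (_/_; _%_)
open import Data.List using (List; []; _∷_; map; length)
open import Data.Integer as ℤ using (ℤ; +_)
open import Data.Product using (_×_)
open import Relation.Binary.PropositionalEquality using (_≡_)

-- base-b digits of a, least significant first, with a fuel bound
-- (fuel a suffices since a / b < a for a > 0, b ≥ 2).  digits of 0 = [].
digitsF : ℕ → (b : ℕ) → .{{NonZero b}} → ℕ → List ℕ
digitsF zero    b a       = []
digitsF (suc f) b zero    = []
digitsF (suc f) b (suc a) = (suc a % b) ∷ digitsF f b (suc a / b)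

digits : (b : ℕ) → .{{NonZero b}} → ℕ → List ℕ
digits b a = digitsF a b a

numDigits : (b : ℕ) → .{{NonZero b}} → ℕ → ℕ
numDigits b a = length (digits b a)

S : (c b : ℕ) → .{{NonZero b}} → ℕ → ℕ
S c b a = c + sum (map (λ d → d * d) (digits b a))

FixedPointWithDigits : (c b : ℕ) → .{{NonZero b}} → ℕ → ℕ → Set
FixedPointWithDigits c b k a = (0 < a) × (S c b a ≡ a) × (numDigits b a ≡ k)

mBound : ℕ → ℕ → ℤ
mBound b n = (+ (b ^ n) ℤ.- + (b ^ 2)) ℤ.+ + (3 * b) ℤ.- + 3

MBound : ℕ → ℕ → ℤ
MBound b n =
  ((+ (b ^ (n + 1)) ℤ.- + (b ^ 2)) ℤ.- (+ (n ∸ 1) ℤ.* (+ (b ∸ 1) ℤ.* + (b ∸ 1))))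
  ℤ.+ (+ (b ∸ (b / 2)) ℤ.* + (b / 2))

-- Writing a = Σ aᵢ bⁱ, a fixed point of S_[c,b] satisfies c = a − S_[0,b](a) = Σ (aᵢ bⁱ − aᵢ²),
-- so c is bounded by bounding each digit's contribution separately. The units digit
-- contributes a₀ − a₀² ∈ [−(b−1)(b−2), 0], the b-digit b a₁ − a₁² ∈ [0, (b − ⌊b/2⌋)⌊b/2⌋],
-- a digit at position i ≥ 2 contributes at most (b−1)bⁱ − (b−1)², and the leading digit
-- (nonzero) at least bⁿ − 1. Summing gives m_{b,n} ≤ c ≤ M_{b,n}, and the digit strings
-- (b−1, 0, …, 0, 1) and (0, ⌊b/2⌋, b−1, …, b−1) attain the two bounds.
module Submission where

open import Defs
open import Data.Nat using (ℕ; zero; suc; _+_; _*_; _∸_; _^_; _≤_; _<_; z≤n; s≤s; NonZero)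
open import Data.Nat.Properties
open import Data.Nat.DivMod
  using (_/_; _%_; m≡m%n+[m/n]*n; m%n<n; m/n<m; [m+kn]%n≡m%n; m<n⇒m%n≡m;
         +-distrib-/-∣ʳ; m<n⇒m/n≡0; m*n/n≡m)
open import Data.Nat.Divisibility using (n∣m*n)
open import Data.Nat.ListAction using (sum)
open import Data.List using (_∷_; map; length)
open import Data.Integer as ℤ using (+_; _⊖_)
import Data.Integer.Properties as ℤP
open import Data.Product using (_×_; _,_; proj₁; proj₂; ∃-syntax)
open import Data.Sum using (inj₁; inj₂)
open import Relation.Binary.PropositionalEquality
import Data.Nat.Tactic.RingSolver as ℕ-Ring
import Data.Integer.Tactic.RingSolver as ℤ-Ring

⊖-shift : ∀ m n k → m ⊖ n ≡ (m + k) ⊖ (n + k)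
⊖-shift m n k = begin
  m ⊖ n             ≡⟨ ℤP.+-cancelˡ-⊖ k m n ⟨
  (k + m) ⊖ (k + n) ≡⟨ cong₂ _⊖_ (+-comm k m) (+-comm k n) ⟩
  (m + k) ⊖ (n + k) ∎
  where open ≡-Reasoning

[m+n]⊖n≡m : ∀ m n → (m + n) ⊖ n ≡ + m
[m+n]⊖n≡m m n = sym (⊖-shift m 0 n)

m+q≤p+n⇒m⊖n≤p⊖q : ∀ m n p q → m + q ≤ p + n → m ⊖ n ℤ.≤ p ⊖ q
m+q≤p+n⇒m⊖n≤p⊖q m n p q le = begin
  m ⊖ n             ≡⟨ ⊖-shift m n q ⟩
  (m + q) ⊖ (n + q) ≤⟨ ℤP.⊖-monoˡ-≤ (n + q) le ⟩
  (p + n) ⊖ (n + q) ≡⟨ cong ((p + n) ⊖_) (+-comm n q) ⟩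
  (p + n) ⊖ (q + n) ≡⟨ ⊖-shift p q n ⟨
  p ⊖ q             ∎
  where open ℤP.≤-Reasoning

m+q≡p+n⇒m⊖n≡p⊖q : ∀ m n p q → m + q ≡ p + n → m ⊖ n ≡ p ⊖ q
m+q≡p+n⇒m⊖n≡p⊖q m n p q eq = begin
  m ⊖ n             ≡⟨ ⊖-shift m n q ⟩
  (m + q) ⊖ (n + q) ≡⟨ cong₂ _⊖_ eq (+-comm n q) ⟩
  (p + n) ⊖ (q + n) ≡⟨ ⊖-shift p q n ⟨
  p ⊖ q             ∎
  where open ≡-Reasoning

mBound≡⊖ : ∀ b n → mBound b n ≡ (b ^ n + 3 * b) ⊖ (b ^ 2 + 3)
mBound≡⊖ b n = begin
  mBound b n                                           ≡⟨ regroup (+ (b ^ n)) (+ (b ^ 2)) (+ (3 * b)) (+ 3) ⟩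
  (+ (b ^ n) ℤ.+ + (3 * b)) ℤ.- (+ (b ^ 2) ℤ.+ + 3) ≡⟨ cong₂ ℤ._-_ (ℤP.pos-+ (b ^ n) (3 * b)) (ℤP.pos-+ (b ^ 2) 3) ⟨
  + (b ^ n + 3 * b) ℤ.- + (b ^ 2 + 3)                ≡⟨ ℤP.[+m]-[+n]≡m⊖n (b ^ n + 3 * b) (b ^ 2 + 3) ⟩
  (b ^ n + 3 * b) ⊖ (b ^ 2 + 3)                        ∎
  where
  open ≡-Reasoning
  regroup : ∀ x y z w → ((x ℤ.- y) ℤ.+ z) ℤ.- w ≡ (x ℤ.+ z) ℤ.- (y ℤ.+ w)
  regroup = ℤ-Ring.solve-∀

MBound≡⊖ : ∀ b n → MBound b n ≡
  (b ^ (n + 1) + (b ∸ b / 2) * (b / 2)) ⊖ (b ^ 2 + (n ∸ 1) * ((b ∸ 1) * (b ∸ 1)))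
MBound≡⊖ b n = begin
  MBound b n
    ≡⟨ cong₂ (λ u v → ((+ (b ^ (n + 1)) ℤ.- + (b ^ 2)) ℤ.- u) ℤ.+ v) pos-N*P*P (sym (ℤP.pos-* Q h)) ⟩
  ((+ (b ^ (n + 1)) ℤ.- + (b ^ 2)) ℤ.- + (N * (P * P))) ℤ.+ + (Q * h)
    ≡⟨ regroup (+ (b ^ (n + 1))) (+ (b ^ 2)) (+ (N * (P * P))) (+ (Q * h)) ⟩
  (+ (b ^ (n + 1)) ℤ.+ + (Q * h)) ℤ.- (+ (b ^ 2) ℤ.+ + (N * (P * P)))
    ≡⟨ cong₂ ℤ._-_ (ℤP.pos-+ (b ^ (n + 1)) (Q * h)) (ℤP.pos-+ (b ^ 2) (N * (P * P))) ⟨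
  + (b ^ (n + 1) + Q * h) ℤ.- + (b ^ 2 + N * (P * P))
    ≡⟨ ℤP.[+m]-[+n]≡m⊖n (b ^ (n + 1) + Q * h) (b ^ 2 + N * (P * P)) ⟩
  (b ^ (n + 1) + Q * h) ⊖ (b ^ 2 + N * (P * P)) ∎
  where
  open ≡-Reasoning
  N = n ∸ 1
  P = b ∸ 1
  Q = b ∸ b / 2
  h = b / 2
  pos-N*P*P : + N ℤ.* (+ P ℤ.* + P) ≡ + (N * (P * P))
  pos-N*P*P = trans (cong (+ N ℤ.*_) (sym (ℤP.pos-* P P))) (sym (ℤP.pos-* N (P * P)))
  regroup : ∀ x y z w → ((x ℤ.- y) ℤ.- z) ℤ.+ w ≡ (x ℤ.+ w) ℤ.- (y ℤ.+ z)
  regroup = ℤ-Ring.solve-∀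

≤-by-slack : ∀ {m n} k → m + k ≡ n → m ≤ n
≤-by-slack k eq = m+n≤o⇒m≤o _ (≤-reflexive eq)

n≤n*n : ∀ n → n ≤ n * n
n≤n*n zero    = z≤n
n≤n*n (suc n) = m≤m*n (suc n) (suc n)

-- (P − d)(d − 1) ≥ 0
d*d+P≤P*d+1 : ∀ {d P} → 1 ≤ d → d < P → d * d + P ≤ P * d + 1
d*d+P≤P*d+1 {suc d} _ d<P with m≤n⇒∃[o]m+o≡n d<P
... | e , refl = ≤-by-slack (e * d) (slack d e)
  where
  slack : ∀ d e → (suc d * suc d + (2 + d + e)) + e * d ≡ (2 + d + e) * suc d + 1
  slack = ℕ-Ring.solve-∀

-- (m − d)(P − m − d) ≥ 0, and P ≥ (m + 1)² ≥ m + d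
P*d+P+m*m≤d*d+P*[1+m] : ∀ {d m P} → d ≤ m → suc m * suc m ≤ P →
                        P * d + P + m * m ≤ d * d + P * suc m
P*d+P+m*m≤d*d+P*[1+m] {d} d≤m le with m≤n⇒∃[o]m+o≡n d≤m | m≤n⇒∃[o]m+o≡n le
... | e , refl | g , refl = ≤-by-slack (g * e + (1 + e + d * d + 2 * d * e + e * e) * e) (slack d e g)
  where
  slack : ∀ d e g → let m = d + e; P = suc m * suc m + g in
    (P * d + P + m * m) + (g * e + (1 + e + d * d + 2 * d * e + e * e) * e) ≡ d * d + P * suc m
  slack = ℕ-Ring.solve-∀

-- (b − 1 − d)(b − 2 − d) ≥ 0
d*d+3*b≤d+b*b+2 : ∀ {d b} → d < b → d * d + 3 * b ≤ d + b * b + 2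
d*d+3*b≤d+b*b+2 {d} d<b with m≤n⇒∃[o]m+o≡n d<b
... | zero  , refl = ≤-reflexive (tight d)
  where
  tight : ∀ d → d * d + 3 * (suc d + 0) ≡ d + (suc d + 0) * (suc d + 0) + 2
  tight = ℕ-Ring.solve-∀
... | suc e , refl = ≤-by-slack (e * e + e + 2 * d + 2 * d * e) (slack d e)
  where
  slack : ∀ d e → let b = suc d + suc e in
    (d * d + 3 * b) + (e * e + e + 2 * d + 2 * d * e) ≡ d + b * b + 2
  slack = ℕ-Ring.solve-∀

-- (d − h)(d − h − r) ≥ 0, since no integer lies strictly between h and h + r ≤ h + 1
[h+[h+r]]*d≤d*d+[h+r]*h : ∀ h r d → r ≤ 1 → (h + (h + r)) * d ≤ d * d + (h + r) * h
[h+[h+r]]*d≤d*d+[h+r]*h h r d r≤1 with ≤-total d h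
... | inj₁ d≤h with m≤n⇒∃[o]m+o≡n d≤h
...   | e , refl = ≤-by-slack (e * e + r * e) (slack d e r)
  where
  slack : ∀ d e r → let h = d + e in
    (h + (h + r)) * d + (e * e + r * e) ≡ d * d + (h + r) * h
  slack = ℕ-Ring.solve-∀
[h+[h+r]]*d≤d*d+[h+r]*h h .0 d z≤n | inj₂ h≤d with m≤n⇒∃[o]m+o≡n h≤d
...   | e , refl = ≤-by-slack (e * e) (slack h e)
  where
  slack : ∀ h e → (h + (h + 0)) * (h + e) + e * e ≡ (h + e) * (h + e) + (h + 0) * h
  slack = ℕ-Ring.solve-∀
[h+[h+r]]*d≤d*d+[h+r]*h h .1 d (s≤s z≤n) | inj₂ h≤d with m≤n⇒∃[o]m+o≡n h≤d
...   | zero  , refl = ≤-reflexive (tight h)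
  where
  tight : ∀ h → (h + (h + 1)) * (h + 0) ≡ (h + 0) * (h + 0) + (h + 1) * h
  tight = ℕ-Ring.solve-∀
...   | suc e , refl = ≤-by-slack (e * e + e) (slack h e)
  where
  slack : ∀ h e → (h + (h + 1)) * (h + suc e) + (e * e + e) ≡ (h + suc e) * (h + suc e) + (h + 1) * h
  slack = ℕ-Ring.solve-∀

b*d≤d*d+[b∸b/2]*[b/2] : ∀ b d → b * d ≤ d * d + (b ∸ b / 2) * (b / 2)
b*d≤d*d+[b∸b/2]*[b/2] b d =
  subst₂ (λ u v → u * d ≤ d * d + v * h) (sym b≡h+[h+r]) (sym b∸h≡h+r)
    ([h+[h+r]]*d≤d*d+[h+r]*h h r d (≤-pred (m%n<n b 2)))
  where
  h = b / 2
  r = b % 2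
  b≡h+[h+r] : b ≡ h + (h + r)
  b≡h+[h+r] = trans (m≡m%n+[m/n]*n b 2) (regroup r h)
    where
    regroup : ∀ r h → r + h * 2 ≡ h + (h + r)
    regroup = ℕ-Ring.solve-∀
  b∸h≡h+r : b ∸ h ≡ h + r
  b∸h≡h+r = trans (cong (_∸ h) b≡h+[h+r]) (m+n∸m≡n h (h + r))

module Base (b' : ℕ) (1≤b' : 1 ≤ b') where

  b : ℕ
  b = suc b'

  private
    1<b : 1 < b
    1<b = s≤s 1≤b'

  digitsF-fuel : ∀ f g a → a ≤ f → a ≤ g → digitsF f b a ≡ digitsF g b a
  digitsF-fuel zero    zero    zero    _         _         = refl
  digitsF-fuel zero    (suc g) zero    _         _         = refl
  digitsF-fuel (suc f) zero    zero    _         _         = refl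
  digitsF-fuel (suc f) (suc g) zero    _         _         = refl
  digitsF-fuel (suc f) (suc g) (suc a) (s≤s a≤f) (s≤s a≤g) =
    cong (suc a % b ∷_) (digitsF-fuel f g (suc a / b) (≤-trans q≤a a≤f) (≤-trans q≤a a≤g))
    where
    q≤a : suc a / b ≤ a
    q≤a = ≤-pred (m/n<m (suc a) b 1<b)

  digits-step : ∀ {a} → 0 < a → digits b a ≡ a % b ∷ digits b (a / b)
  digits-step {suc a} _ =
    cong (suc a % b ∷_) (digitsF-fuel a (suc a / b) (suc a / b) (≤-pred (m/n<m (suc a) b 1<b)) ≤-refl)

  digits-cons : ∀ {d} x → d < b → 0 < d + x * b → digits b (d + x * b) ≡ d ∷ digits b x
  digits-cons {d} x d<b pos = trans (digits-step pos) (cong₂ (λ r q → r ∷ digits b q) mod≡d div≡x)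
    where
    open ≡-Reasoning
    mod≡d : (d + x * b) % b ≡ d
    mod≡d = trans ([m+kn]%n≡m%n d x b) (m<n⇒m%n≡m d<b)
    div≡x : (d + x * b) / b ≡ x
    div≡x = begin
      (d + x * b) / b   ≡⟨ +-distrib-/-∣ʳ d (n∣m*n x) ⟩
      d / b + x * b / b ≡⟨ cong₂ _+_ (m<n⇒m/n≡0 d<b) (m*n/n≡m x b) ⟩
      x                 ∎

  sqDigitSum : ℕ → ℕ
  sqDigitSum a = sum (map (λ d → d * d) (digits b a))

  sqDigitSum-cons : ∀ {d} x → d < b → 0 < d + x * b → sqDigitSum (d + x * b) ≡ d * d + sqDigitSum x
  sqDigitSum-cons x d<b pos = cong (λ ds → sum (map (λ d → d * d) ds)) (digits-cons x d<b pos)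

  numDigits-cons : ∀ {d} x → d < b → 0 < d + x * b → numDigits b (d + x * b) ≡ suc (numDigits b x)
  numDigits-cons x d<b pos = cong length (digits-cons x d<b pos)

  numDigits≡0⇒≡0 : ∀ a → numDigits b a ≡ 0 → a ≡ 0
  numDigits≡0⇒≡0 zero _ = refl

  numDigits≡suc⇒>0 : ∀ a {k} → numDigits b a ≡ suc k → 0 < a
  numDigits≡suc⇒>0 (suc a) _ = s≤s z≤n

  peelDigit : ∀ a {k} → numDigits b a ≡ suc k →
              ∃[ d ] ∃[ q ] d < b × a ≡ d + q * b × sqDigitSum a ≡ d * d + sqDigitSum q × numDigits b q ≡ k
  peelDigit a len =
    a % b , a / b , d<b , a≡ ,
    trans (cong sqDigitSum a≡) (sqDigitSum-cons (a / b) d<b pos′) ,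
    suc-injective (trans (sym (numDigits-cons (a / b) d<b pos′)) (trans (cong (numDigits b) (sym a≡)) len))
    where
    d<b : a % b < b
    d<b = m%n<n a b
    a≡ : a ≡ a % b + a / b * b
    a≡ = m≡m%n+[m/n]*n a b
    pos′ : 0 < a % b + a / b * b
    pos′ = subst (0 <_) a≡ (numDigits≡suc⇒>0 a len)

  b≤b^p : ∀ {p} → 1 ≤ p → b ≤ b ^ p
  b≤b^p {suc p} _ = subst (_≤ b * b ^ p) (*-identityʳ b) (*-monoʳ-≤ b (m^n>0 b p))

  b*b≤b^p : ∀ {p} → 2 ≤ p → b * b ≤ b ^ p
  b*b≤b^p {suc p} (s≤s 1≤p) = *-monoʳ-≤ b (b≤b^p 1≤p)

  -- the digits of t sit at positions p, p+1, …, p+k; the leading one is nonzero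
  sqDigitSum+b^[p+k]≤b^p*t+1 : ∀ k t p → numDigits b t ≡ suc k → 1 ≤ p →
                               sqDigitSum t + b ^ (p + k) ≤ b ^ p * t + 1
  sqDigitSum+b^[p+k]≤b^p*t+1 zero t p len 1≤p with peelDigit t len
  ... | d , q , d<b , refl , sq≡ , lenq with numDigits≡0⇒≡0 q lenq
  ... | refl = begin
    sqDigitSum (d + 0) + b ^ (p + 0) ≡⟨ cong₂ _+_ (trans sq≡ (+-identityʳ (d * d))) (cong (b ^_) (+-identityʳ p)) ⟩
    d * d + b ^ p                    ≤⟨ d*d+P≤P*d+1 1≤d (≤-trans d<b (b≤b^p 1≤p)) ⟩
    b ^ p * d + 1                    ≡⟨ cong (λ v → b ^ p * v + 1) (+-identityʳ d) ⟨
    b ^ p * (d + 0) + 1              ∎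
    where
    open ≤-Reasoning
    1≤d : 1 ≤ d
    1≤d = subst (0 <_) (+-identityʳ d) (numDigits≡suc⇒>0 (d + 0) len)
  sqDigitSum+b^[p+k]≤b^p*t+1 (suc k) t p len 1≤p with peelDigit t len
  ... | d , q , d<b , refl , sq≡ , lenq = begin
    sqDigitSum (d + q * b) + b ^ (p + suc k) ≡⟨ cong₂ _+_ sq≡ (cong (b ^_) (+-suc p k)) ⟩
    d * d + sqDigitSum q + b ^ (suc p + k)   ≡⟨ +-assoc (d * d) _ _ ⟩
    d * d + (sqDigitSum q + b ^ (suc p + k))
      ≤⟨ +-mono-≤ (*-monoˡ-≤ d (≤-trans (<⇒≤ d<b) (b≤b^p 1≤p)))
                  (sqDigitSum+b^[p+k]≤b^p*t+1 k q (suc p) lenq (s≤s z≤n)) ⟩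
    b ^ p * d + (b * b ^ p * q + 1)          ≡⟨ regroup (b ^ p) d q b ⟩
    b ^ p * (d + q * b) + 1                  ∎
    where
    open ≤-Reasoning
    regroup : ∀ P d q b → P * d + (b * P * q + 1) ≡ P * (d + q * b) + 1
    regroup = ℕ-Ring.solve-∀

  -- the digits of t sit at positions p, …, p+k−1; here t may have leading zeros, even t = 0
  b^p*t+b^p+k*b'²≤sqDigitSum+b^[p+k] : ∀ k t p → numDigits b t ≡ k → 2 ≤ p →
                                      b ^ p * t + b ^ p + k * (b' * b') ≤ sqDigitSum t + b ^ (p + k)
  b^p*t+b^p+k*b'²≤sqDigitSum+b^[p+k] zero t p len _ with numDigits≡0⇒≡0 t len
  ... | refl = ≤-reflexive (trans (+-identityʳ _)
                 (cong₂ _+_ (*-zeroʳ (b ^ p)) (cong (b ^_) (sym (+-identityʳ p)))))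
  b^p*t+b^p+k*b'²≤sqDigitSum+b^[p+k] (suc k) t p len 2≤p with peelDigit t len
  ... | d , q , d<b , refl , sq≡ , lenq = begin
    b ^ p * (d + q * b) + b ^ p + suc k * B
      ≡⟨ regroup₁ (b ^ p) d q b B (k * B) ⟩
    (b ^ p * d + b ^ p + B) + (b * b ^ p * q + k * B)
      ≤⟨ +-monoˡ-≤ _ (P*d+P+m*m≤d*d+P*[1+m] (≤-pred d<b) (b*b≤b^p 2≤p)) ⟩
    (d * d + b ^ p * b) + (b * b ^ p * q + k * B)
      ≡⟨ regroup₂ (b ^ p) d q b (k * B) ⟩
    d * d + (b * b ^ p * q + b * b ^ p + k * B)
      ≤⟨ +-monoʳ-≤ (d * d) (b^p*t+b^p+k*b'²≤sqDigitSum+b^[p+k] k q (suc p) lenq (m≤n⇒m≤1+n 2≤p)) ⟩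
    d * d + (sqDigitSum q + b ^ (suc p + k))
      ≡⟨ +-assoc (d * d) _ _ ⟨
    d * d + sqDigitSum q + b ^ (suc p + k)
      ≡⟨ cong₂ _+_ sq≡ (cong (b ^_) (+-suc p k)) ⟨
    sqDigitSum (d + q * b) + b ^ (p + suc k) ∎
    where
    open ≤-Reasoning
    B = b' * b'
    regroup₁ : ∀ P d q b B K → P * (d + q * b) + P + (B + K) ≡ (P * d + P + B) + (b * P * q + K)
    regroup₁ = ℕ-Ring.solve-∀
    regroup₂ : ∀ P d q b K → (d * d + P * b) + (b * P * q + K) ≡ d * d + (b * P * q + b * P + K)
    regroup₂ = ℕ-Ring.solve-∀

  lowerBound : ∀ {k} a → numDigits b a ≡ 3 + k →
               b ^ (2 + k) + 3 * b + sqDigitSum a ≤ a + (b ^ 2 + 3)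
  lowerBound {k} a len with peelDigit a len
  ... | d₀ , q , d₀<b , refl , sq₀ , lenq with peelDigit q lenq
  ... | d₁ , t , d₁<b , refl , sq₁ , lent = begin
    b ^ (2 + k) + 3 * b + sqDigitSum a
      ≡⟨ cong (λ s → b ^ (2 + k) + 3 * b + s) (trans sq₀ (cong (_+_ (d₀ * d₀)) sq₁)) ⟩
    b ^ (2 + k) + 3 * b + (d₀ * d₀ + (d₁ * d₁ + sqDigitSum t))
      ≡⟨ regroup₁ (d₀ * d₀) (d₁ * d₁) (sqDigitSum t) (b ^ (2 + k)) (3 * b) ⟩
    (sqDigitSum t + b ^ (2 + k)) + d₁ * d₁ + (d₀ * d₀ + 3 * b)
      ≤⟨ +-mono-≤ (+-mono-≤ (sqDigitSum+b^[p+k]≤b^p*t+1 k t 2 lent (s≤s z≤n)) (*-monoˡ-≤ d₁ (<⇒≤ d₁<b)))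
                  (d*d+3*b≤d+b*b+2 d₀<b) ⟩
    (b ^ 2 * t + 1) + b * d₁ + (d₀ + b * b + 2)
      ≡⟨ regroup₂ b t d₁ d₀ ⟩
    a + (b ^ 2 + 3) ∎
    where
    open ≤-Reasoning
    regroup₁ : ∀ x y z P Q → P + Q + (x + (y + z)) ≡ (z + P) + y + (x + Q)
    regroup₁ = ℕ-Ring.solve-∀
    regroup₂ : ∀ b t d₁ d₀ → (b * (b * 1) * t + 1) + b * d₁ + (d₀ + b * b + 2) ≡
                            d₀ + (d₁ + t * b) * b + (b * (b * 1) + 3)
    regroup₂ = ℕ-Ring.solve-∀

  upperBound : ∀ {k} a → numDigits b a ≡ 3 + k →
               a + (b ^ 2 + suc k * (b' * b')) ≤ b ^ (2 + k + 1) + (b ∸ b / 2) * (b / 2) + sqDigitSum a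
  upperBound {k} a len with peelDigit a len
  ... | d₀ , q , d₀<b , refl , sq₀ , lenq with peelDigit q lenq
  ... | d₁ , t , d₁<b , refl , sq₁ , lent = begin
    a + (b ^ 2 + suc k * B)
      ≡⟨ regroup₁ b t d₁ d₀ (suc k * B) ⟩
    d₀ + b * d₁ + (b ^ 2 * t + b ^ 2 + suc k * B)
      ≤⟨ +-mono-≤ (+-mono-≤ (n≤n*n d₀) (b*d≤d*d+[b∸b/2]*[b/2] b d₁))
                  (b^p*t+b^p+k*b'²≤sqDigitSum+b^[p+k] (suc k) t 2 lent (s≤s (s≤s z≤n))) ⟩
    d₀ * d₀ + (d₁ * d₁ + Qh) + (sqDigitSum t + b ^ (2 + suc k))
      ≡⟨ cong (λ e → d₀ * d₀ + (d₁ * d₁ + Qh) + (sqDigitSum t + b ^ e)) (cong suc (cong suc (+-comm 1 k))) ⟩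
    d₀ * d₀ + (d₁ * d₁ + Qh) + (sqDigitSum t + b ^ (2 + k + 1))
      ≡⟨ regroup₂ (d₀ * d₀) (d₁ * d₁) Qh (sqDigitSum t) (b ^ (2 + k + 1)) ⟩
    b ^ (2 + k + 1) + Qh + (d₀ * d₀ + (d₁ * d₁ + sqDigitSum t))
      ≡⟨ cong (λ s → b ^ (2 + k + 1) + Qh + s) (trans sq₀ (cong (_+_ (d₀ * d₀)) sq₁)) ⟨
    b ^ (2 + k + 1) + Qh + sqDigitSum a ∎
    where
    open ≤-Reasoning
    B = b' * b'
    Qh = (b ∸ b / 2) * (b / 2)
    regroup₁ : ∀ b t d₁ d₀ K → d₀ + (d₁ + t * b) * b + (b * (b * 1) + K) ≡
                              d₀ + b * d₁ + (b * (b * 1) * t + b * (b * 1) + K)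
    regroup₁ = ℕ-Ring.solve-∀
    regroup₂ : ∀ x y Q z P → x + (y + Q) + (z + P) ≡ P + Q + (x + (y + z))
    regroup₂ = ℕ-Ring.solve-∀

  sqDigitSum[a]≤a : ∀ {k} a → numDigits b a ≡ 3 + k → sqDigitSum a ≤ a
  sqDigitSum[a]≤a {k} a len = +-cancelˡ-≤ (b ^ 2 + 3) _ _ (begin
    b ^ 2 + 3 + sqDigitSum a             ≤⟨ +-monoˡ-≤ _ (+-mono-≤ (^-monoʳ-≤ b (m≤m+n 2 k)) (m≤m*n 3 b)) ⟩
    b ^ (2 + k) + 3 * b + sqDigitSum a ≤⟨ lowerBound a len ⟩
    a + (b ^ 2 + 3)                      ≡⟨ +-comm a _ ⟩
    b ^ 2 + 3 + a                        ∎)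
    where open ≤-Reasoning

  fixedPoint⇒c≡a⊖sqDigitSum : ∀ {c a} → S c b a ≡ a → + c ≡ a ⊖ sqDigitSum a
  fixedPoint⇒c≡a⊖sqDigitSum {c} {a} fixed = trans (sym ([m+n]⊖n≡m c (sqDigitSum a))) (cong (_⊖ sqDigitSum a) fixed)

  b^-digits : ∀ j → sqDigitSum (b ^ j) ≡ 1 × numDigits b (b ^ j) ≡ suc j
  b^-digits zero = sqDigitSum-cons 0 1<b (s≤s z≤n) , numDigits-cons 0 1<b (s≤s z≤n)
  b^-digits (suc j) with b^-digits j
  ... | sq≡ , len≡ =
    trans (cong sqDigitSum shift) (trans (sqDigitSum-cons (b ^ j) (s≤s z≤n) pos) sq≡) ,
    trans (cong (numDigits b) shift) (trans (numDigits-cons (b ^ j) (s≤s z≤n) pos) (cong suc len≡))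
    where
    shift : b ^ suc j ≡ 0 + b ^ j * b
    shift = *-comm b (b ^ j)
    pos : 0 < 0 + b ^ j * b
    pos = subst (0 <_) shift (m^n>0 b (suc j))

  largestWithDigits : ℕ → ℕ
  largestWithDigits zero    = 0
  largestWithDigits (suc j) = b' + largestWithDigits j * b

  largestWithDigits+1≡b^ : ∀ j → largestWithDigits j + 1 ≡ b ^ j
  largestWithDigits+1≡b^ zero    = refl
  largestWithDigits+1≡b^ (suc j) = trans (regroup b' (largestWithDigits j)) (cong (b *_) (largestWithDigits+1≡b^ j))
    where
    regroup : ∀ b' x → b' + x * suc b' + 1 ≡ suc b' * (x + 1)
    regroup = ℕ-Ring.solve-∀

  largestWithDigits-digits : ∀ j →
    sqDigitSum (largestWithDigits j) ≡ j * (b' * b') × numDigits b (largestWithDigits j) ≡ j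
  largestWithDigits-digits zero    = refl , refl
  largestWithDigits-digits (suc j) with largestWithDigits-digits j
  ... | sq≡ , len≡ =
    trans (sqDigitSum-cons (largestWithDigits j) (n<1+n b') pos) (cong (_+_ (b' * b')) sq≡) ,
    trans (numDigits-cons (largestWithDigits j) (n<1+n b') pos) (cong suc len≡)
    where
    pos : 0 < b' + largestWithDigits j * b
    pos = ≤-trans 1≤b' (m≤m+n b' _)

  mBound≤a⊖sqDigitSum : ∀ {k} a → numDigits b a ≡ 3 + k → mBound b (2 + k) ℤ.≤ a ⊖ sqDigitSum a
  mBound≤a⊖sqDigitSum {k} a len = subst (ℤ._≤ a ⊖ sqDigitSum a) (sym (mBound≡⊖ b (2 + k)))
    (m+q≤p+n⇒m⊖n≤p⊖q _ _ a (sqDigitSum a) (lowerBound a len))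

  a⊖sqDigitSum≤MBound : ∀ {k} a → numDigits b a ≡ 3 + k → a ⊖ sqDigitSum a ℤ.≤ MBound b (2 + k)
  a⊖sqDigitSum≤MBound {k} a len = subst (a ⊖ sqDigitSum a ℤ.≤_) (sym (MBound≡⊖ b (2 + k)))
    (m+q≤p+n⇒m⊖n≤p⊖q a (sqDigitSum a) _ _ (upperBound a len))

  fixedPoint-bounds : ∀ {k} c → ∃[ a ] FixedPointWithDigits c b (3 + k) a →
                      (mBound b (2 + k) ℤ.≤ + c) × (+ c ℤ.≤ MBound b (2 + k))
  fixedPoint-bounds {k} c (a , _ , fixed , len) =
    subst (mBound b (2 + k) ℤ.≤_) c≡ (mBound≤a⊖sqDigitSum a len) ,
    subst (ℤ._≤ MBound b (2 + k)) c≡ (a⊖sqDigitSum≤MBound a len)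
    where
    c≡ : a ⊖ sqDigitSum a ≡ + c
    c≡ = sym (fixedPoint⇒c≡a⊖sqDigitSum fixed)

  bound-attained : ∀ {k} a {x y z} → numDigits b a ≡ 3 + k → z ≡ x ⊖ y → a + y ≡ x + sqDigitSum a →
                   ∃[ c ] ((+ c ≡ z) × (∃[ a ] FixedPointWithDigits c b (3 + k) a))
  bound-attained a {x} {y} len z≡ balance =
    a ∸ sqDigitSum a ,
    trans (sym (ℤP.⊖-≥ s≤a)) (trans (m+q≡p+n⇒m⊖n≡p⊖q a (sqDigitSum a) x y balance) (sym z≡)) ,
    a , numDigits≡suc⇒>0 a len , m∸n+n≡m s≤a , len
    where
    s≤a : sqDigitSum a ≤ a
    s≤a = sqDigitSum[a]≤a a len

  mBound-attained : ∀ k → ∃[ c ] ((+ c ≡ mBound b (2 + k)) × (∃[ a ] FixedPointWithDigits c b (3 + k) a))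
  mBound-attained k = bound-attained a len (mBound≡⊖ b (2 + k)) balance
    where
    X = b ^ suc k
    a = b' + X * b
    pos : 0 < a
    pos = ≤-trans 1≤b' (m≤m+n b' _)
    len : numDigits b a ≡ 3 + k
    len = trans (numDigits-cons X (n<1+n b') pos) (cong suc (proj₂ (b^-digits (suc k))))
    sq≡ : sqDigitSum a ≡ b' * b' + 1
    sq≡ = trans (sqDigitSum-cons X (n<1+n b') pos) (cong (_+_ (b' * b')) (proj₁ (b^-digits (suc k))))
    balance : a + (b ^ 2 + 3) ≡ b ^ (2 + k) + 3 * b + sqDigitSum a
    balance = trans (regroup b' X) (cong (_+_ (b * X + 3 * b)) (sym sq≡))
      where
      regroup : ∀ b' X → b' + X * suc b' + (suc b' * (suc b' * 1) + 3) ≡ suc b' * X + 3 * suc b' + (b' * b' + 1)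
      regroup = ℕ-Ring.solve-∀

  MBound-attained : ∀ k → ∃[ c ] ((+ c ≡ MBound b (2 + k)) × (∃[ a ] FixedPointWithDigits c b (3 + k) a))
  MBound-attained k = bound-attained a len (MBound≡⊖ b (2 + k)) balance
    where
    h = b / 2
    L = largestWithDigits (suc k)
    y = h + L * b
    a = y * b
    h<b : h < b
    h<b = m/n<m b 2 (s≤s (s≤s z≤n))
    pos-y : 0 < y
    pos-y = ≤-trans (≤-trans 1≤b' (m≤m+n b' _)) (≤-trans (m≤m*n L b) (m≤n+m (L * b) h))
    pos-a : 0 < a
    pos-a = ≤-trans pos-y (m≤m*n y b)
    len : numDigits b a ≡ 3 + k
    len = trans (numDigits-cons y (s≤s z≤n) pos-a) (cong suc (trans (numDigits-cons L h<b pos-y)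
                (cong suc (proj₂ (largestWithDigits-digits (suc k))))))
    sq≡ : sqDigitSum a ≡ h * h + suc k * (b' * b')
    sq≡ = trans (sqDigitSum-cons y (s≤s z≤n) pos-a) (trans (sqDigitSum-cons L h<b pos-y)
                (cong (_+_ (h * h)) (proj₁ (largestWithDigits-digits (suc k)))))
    balance : a + (b ^ 2 + suc k * (b' * b')) ≡ b ^ (2 + k + 1) + (b ∸ h) * h + sqDigitSum a
    balance = begin
      (h + L * b) * b + (b ^ 2 + K)
        ≡⟨ regroup₁ h L b K ⟩
      b * (b * (L + 1)) + b * h + K
        ≡⟨ cong₂ (λ u v → b * (b * u) + v * h + K) (largestWithDigits+1≡b^ (suc k)) (sym (m∸n+n≡m (<⇒≤ h<b))) ⟩
      b ^ (3 + k) + (b ∸ h + h) * h + K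
        ≡⟨ cong (λ e → b ^ e + (b ∸ h + h) * h + K) (cong suc (cong suc (+-comm 1 k))) ⟩
      b ^ (2 + k + 1) + (b ∸ h + h) * h + K
        ≡⟨ regroup₂ (b ^ (2 + k + 1)) (b ∸ h) h K ⟩
      b ^ (2 + k + 1) + (b ∸ h) * h + (h * h + K)
        ≡⟨ cong (_+_ (b ^ (2 + k + 1) + (b ∸ h) * h)) (sym sq≡) ⟩
      b ^ (2 + k + 1) + (b ∸ h) * h + sqDigitSum a ∎
      where
      open ≡-Reasoning
      K = suc k * (b' * b')
      regroup₁ : ∀ h L b K → (h + L * b) * b + (b * (b * 1) + K) ≡ b * (b * (L + 1)) + b * h + K
      regroup₁ = ℕ-Ring.solve-∀
      regroup₂ : ∀ Z Q h K → Z + (Q + h) * h + K ≡ Z + Q * h + (h * h + K)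
      regroup₂ = ℕ-Ring.solve-∀

theorem4p2 : (b n : ℕ) → .{{_ : NonZero b}} → 2 ≤ b → 2 ≤ n →
    ((c : ℕ) → (∃[ a ] FixedPointWithDigits c b (ℕ.suc n) a) →
      (mBound b n ℤ.≤ + c) × (+ c ℤ.≤ MBound b n))
    × (∃[ c ] ((+ c ≡ mBound b n) × (∃[ a ] FixedPointWithDigits c b (ℕ.suc n) a)))
    × (∃[ c ] ((+ c ≡ MBound b n) × (∃[ a ] FixedPointWithDigits c b (ℕ.suc n) a)))
theorem4p2 (suc b') (suc (suc k)) (s≤s 1≤b') (s≤s (s≤s z≤n)) =
  fixedPoint-bounds , mBound-attained k , MBound-attained k
  where open Base b' 1≤b'
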